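{- Let $n\ge 1$ and let $\boldsymbol{\pi}\in\mathfrak{S}_n$ be written as a concatenation $\boldsymbol{\pi}=AB$, where $A$ is a (possibly empty) initial segment and $B$ is the remaining final segment of $\boldsymbol{\pi}$, with the entries of $B$ in increasing order. Then $\boldsymbol{\pi}$ is $|A|$-stack-sortable, i.e. $s^{|A|}(\boldsymbol{\pi})=\mathbf{e}$, where $|A|$ is the number of entries of $A$.
   Context: Permutations $\boldsymbol{\pi}=\pi_1\pi_2\cdots\pi_n\in\mathfrak{S}_n$ are written in one-line notation; $\mathbf{e}=12\cdots n$ is the identity. The stack-sorting map $s$ is defined as follows: start with an empty stack and read $\pi_1,\dots,\pi_n$ from left to right; for each $\pi_k$, while the stack is nonempty and its top element $t$ satisfies $t<\pi_k$, pop $t$ and append it to the output; then push $\pi_k$ onto the stack. After all entries are read, pop the remaining stack elements one at a time, appending each to the output. The output word is $s(\boldsymbol{\pi})$. $s^k$ denotes the $k$-fold iterate ($s^0$ is the identity map). $\boldsymbol{\pi}$ is called $k$-stack-sortable if $s^k(\boldsymbol{\pi})=\mathbf{e}$. -}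

module Defs where

open import Data.Nat using (ℕ; zero; suc; _<_; _<?_)
open import Data.List using (List; []; _∷_; _++_; reverse; applyUpTo)
open import Relation.Nullary using (yes; no)

idPerm : ℕ → List ℕ
idPerm n = applyUpTo suc n

-- One step of the stack: given the incoming entry x and the current stack
-- (top first), pop every top element t with t < x (appending them to the
-- output, in popping order), then push x.
record Popped : Set where
  constructor _,_
  field
    out   : List ℕ
    stack : List ℕ

popPush : ℕ → List ℕ → Popped
popPush x [] = [] , (x ∷ [])
popPush x (t ∷ st) with t <? x
... | yes _ with popPush x st
...   | o , st' = (t ∷ o) , st'
popPush x (t ∷ st) | no _ = [] , (x ∷ t ∷ st)

run : List ℕ → List ℕ → List ℕ
run [] st = st
run (x ∷ xs) st with popPush x st
... | o , st' = o ++ run xs st'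

stackSort : List ℕ → List ℕ
stackSort π = run π []

stackSortIter : ℕ → List ℕ → List ℕ
stackSortIter zero π = π
stackSortIter (suc k) π = stackSortIter k (stackSort π)

{-# OPTIONS --safe #-}
-- The stack is always increasing from
-- the top, and the last entry of A is still on it when B starts; from then on
-- the stack merges B with its contents, so s(AB) = A'B' with B' increasing and
-- |A'| ≤ |A| − 1. After |A| passes the unsorted prefix is empty,
-- and the only increasing rearrangement of e is e itself.
module Submission where

open import Defs
open import Data.Nat using (ℕ; zero; suc; pred; _+_; _≤_; _<_; _<?_; z≤n; s≤s⁻¹; z<s)
open import Data.Nat.Properties using (≤-refl; ≤-trans; <⇒≤; ≮⇒≥; m<m+n; pred-mono-≤; ≤-totalOrder; n≤1+n)
open import Data.List using (List; []; _∷_; _++_; length; takeWhile; dropWhile)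
open import Data.List.Properties using (++-assoc; ++-identityʳ; length-++; takeWhile++dropWhile)
open import Data.List.Relation.Unary.All using (All)
import Data.List.Relation.Unary.All as All
import Data.List.Relation.Unary.All.Properties as All
import Data.List.Relation.Unary.AllPairs.Properties as AllPairs
open import Data.List.Relation.Unary.Linked using (Linked; []; [-]; _∷_)
import Data.List.Relation.Unary.Linked as Linked
open import Data.List.Relation.Unary.Linked.Properties using (Linked⇒All)
open import Data.List.Relation.Unary.Sorted.TotalOrder ≤-totalOrder using (Sorted)
open import Data.List.Relation.Unary.Sorted.TotalOrder.Properties using (Sorted⇒AllPairs; AllPairs⇒Sorted; applyUpTo⁺₂; ↗↭↗⇒≋)
open import Data.List.Relation.Binary.Permutation.Propositional using (_↭_; ↭-refl; ↭-sym; ↭-trans; ↭-prep; ↭-reflexive; ↭⇒↭ₛ; module PermutationReasoning)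
open import Data.List.Relation.Binary.Permutation.Propositional.Properties using (↭-length; ++⁺ˡ; shift; shifts; All-resp-↭)
open import Data.List.Relation.Binary.Pointwise using (Pointwise-≡⇒≡)
open import Data.Product using (∃₂; _×_; _,_)
open import Relation.Binary.Core using (Rel)
open import Relation.Binary.PropositionalEquality using (_≡_; refl; sym; cong; subst; module ≡-Reasoning)
open import Relation.Nullary using (yes; no)
open import Relation.Nullary.Decidable using (dec-true; dec-false)

open Popped

Linked-++⁻ˡ : ∀ {a ℓ} {A : Set a} {R : Rel A ℓ} xs {ys} → Linked R (xs ++ ys) → Linked R xs
Linked-++⁻ˡ []           _         = []
Linked-++⁻ˡ (x ∷ [])     _         = [-]
Linked-++⁻ˡ (x ∷ y ∷ xs) (r ∷ rxs) = r ∷ Linked-++⁻ˡ (y ∷ xs) rxs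

sorted-++ : ∀ {b xs ys} → Sorted xs → Sorted ys → All (_≤ b) xs → All (b ≤_) ys → Sorted (xs ++ ys)
sorted-++ xs↗ ys↗ xs≤b b≤ys = AllPairs⇒Sorted ≤-totalOrder
  (AllPairs.++⁺ (Sorted⇒AllPairs ≤-totalOrder xs↗) (Sorted⇒AllPairs ≤-totalOrder ys↗)
                (All.map (λ x≤b → All.map (≤-trans x≤b) b≤ys) xs≤b))

sorted⇒head≤ : ∀ {x xs} → Sorted (x ∷ xs) → All (x ≤_) (x ∷ xs)
sorted⇒head≤ = Linked⇒All ≤-trans ≤-refl

-- takeWhile and dropWhile reduce to t <ᵇ x, which 'with t <? x' does not
-- abstract; dec-true and dec-false make them compute.
popPush≡span : ∀ x st → popPush x st ≡ (takeWhile (_<? x) st , x ∷ dropWhile (_<? x) st)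
popPush≡span x []       = refl
popPush≡span x (t ∷ st) with t <? x
... | yes t<x rewrite dec-true (t <? x) t<x | popPush≡span x st = refl
... | no t≮x rewrite dec-false (t <? x) t≮x = refl

run-∷ : ∀ x xs st → run (x ∷ xs) st ≡ takeWhile (_<? x) st ++ run xs (x ∷ dropWhile (_<? x) st)
run-∷ x xs st rewrite popPush≡span x st = refl

push-↭ : ∀ x st → takeWhile (_<? x) st ++ x ∷ dropWhile (_<? x) st ↭ x ∷ st
push-↭ x st = ↭-trans (shift x (takeWhile (_<? x) st) _)
                      (↭-prep x (↭-reflexive (takeWhile++dropWhile (_<? x) st)))

push-sorted : ∀ x {st} → Sorted st → Sorted (x ∷ dropWhile (_<? x) st)
push-sorted x {[]}     _   = [-]
push-sorted x {t ∷ st} st↗ with t <? x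
... | yes t<x rewrite dec-true (t <? x) t<x = push-sorted x (Linked.tail st↗)
... | no t≮x rewrite dec-false (t <? x) t≮x = ≮⇒≥ t≮x ∷ st↗

popped-sorted : ∀ x {st} → Sorted st → Sorted (takeWhile (_<? x) st)
popped-sorted x {st} st↗ =
  Linked-++⁻ˡ (takeWhile (_<? x) st) (subst Sorted (sym (takeWhile++dropWhile (_<? x) st)) st↗)

run-↭ : ∀ xs st → run xs st ↭ xs ++ st
run-↭ []       st = ↭-refl
run-↭ (x ∷ xs) st = begin
  run (x ∷ xs) st                 ≡⟨ run-∷ x xs st ⟩
  T ++ run xs (x ∷ D)             ↭⟨ ++⁺ˡ T (run-↭ xs (x ∷ D)) ⟩
  T ++ xs ++ x ∷ D                ↭⟨ shifts T xs ⟩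
  xs ++ T ++ x ∷ D                ↭⟨ ++⁺ˡ xs (push-↭ x st) ⟩
  xs ++ x ∷ st                    ↭⟨ shift x xs st ⟩
  x ∷ xs ++ st                    ∎
  where
  open PermutationReasoning
  T = takeWhile (_<? x) st
  D = dropWhile (_<? x) st

stackSort-↭ : ∀ π → stackSort π ↭ π
stackSort-↭ π = subst (run π [] ↭_) (++-identityʳ π) (run-↭ π [])

stackSortIter-↭ : ∀ k π → stackSortIter k π ↭ π
stackSortIter-↭ zero    π = ↭-refl
stackSortIter-↭ (suc k) π = ↭-trans (stackSortIter-↭ k (stackSort π)) (stackSort-↭ π)

run-sorted : ∀ {xs st} → Sorted xs → Sorted st → Sorted (run xs st)
run-sorted {[]}     _   st↗ = st↗
run-sorted {x ∷ xs} {st} xs↗ st↗ = subst Sorted (sym (run-∷ x xs st))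
  (sorted-++ (popped-sorted x st↗) (run-sorted (Linked.tail xs↗) (push-sorted x st↗))
             (All.map <⇒≤ (All.all-takeWhile (_<? x) st)) x≤rest)
  where
  x≤rest : All (x ≤_) (run xs (x ∷ dropWhile (_<? x) st))
  x≤rest = All-resp-↭ (↭-sym (run-↭ xs _))
    (All.++⁺ (All.tail (sorted⇒head≤ xs↗)) (sorted⇒head≤ (push-sorted x st↗)))

runPrefix : List ℕ → List ℕ → Popped
runPrefix []       st = [] , st
runPrefix (x ∷ xs) st with runPrefix xs (x ∷ dropWhile (_<? x) st)
... | o , st' = takeWhile (_<? x) st ++ o , st'

run-++ : ∀ xs ys st → run (xs ++ ys) st ≡ out (runPrefix xs st) ++ run ys (stack (runPrefix xs st))
run-++ []       ys st = refl
run-++ (x ∷ xs) ys st = begin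
  run (x ∷ xs ++ ys) st                    ≡⟨ run-∷ x (xs ++ ys) st ⟩
  T ++ run (xs ++ ys) (x ∷ D)              ≡⟨ cong (T ++_) (run-++ xs ys (x ∷ D)) ⟩
  T ++ out p ++ run ys (stack p)           ≡⟨ ++-assoc T (out p) _ ⟨
  (T ++ out p) ++ run ys (stack p)         ∎
  where
  open ≡-Reasoning
  T = takeWhile (_<? x) st
  D = dropWhile (_<? x) st
  p = runPrefix xs (x ∷ D)

runPrefix-↭ : ∀ xs st → out (runPrefix xs st) ++ stack (runPrefix xs st) ↭ xs ++ st
runPrefix-↭ xs st = begin
  out p ++ stack p  ≡⟨ run-++ xs [] st ⟨
  run (xs ++ []) st ↭⟨ run-↭ (xs ++ []) st ⟩
  (xs ++ []) ++ st  ≡⟨ cong (_++ st) (++-identityʳ xs) ⟩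
  xs ++ st          ∎
  where
  open PermutationReasoning
  p = runPrefix xs st

runPrefix-sorted : ∀ xs {st} → Sorted st → Sorted (stack (runPrefix xs st))
runPrefix-sorted []       st↗ = st↗
runPrefix-sorted (x ∷ xs) st↗ = runPrefix-sorted xs (push-sorted x st↗)

runPrefix-nonempty : ∀ xs {st} → 0 < length st → 0 < length (stack (runPrefix xs st))
runPrefix-nonempty []       0<|st| = 0<|st|
runPrefix-nonempty (x ∷ xs) _      = runPrefix-nonempty xs z<s

stackSort-shortens-prefix : ∀ xs {ys} → Sorted ys →
  ∃₂ λ xs′ ys′ → stackSort (xs ++ ys) ≡ xs′ ++ ys′ × length xs′ ≤ pred (length xs) × Sorted ys′
stackSort-shortens-prefix []        ys↗ = [] , _ , refl , z≤n , run-sorted ys↗ []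
stackSort-shortens-prefix (x ∷ xs) {ys} ys↗ =
  out p , run ys (stack p) , run-++ (x ∷ xs) ys [] , |out|≤|xs| ,
  run-sorted ys↗ (runPrefix-sorted (x ∷ xs) [])
  where
  p = runPrefix (x ∷ xs) []

  |out|+|stack| : length (out p) + length (stack p) ≡ suc (length xs)
  |out|+|stack| = begin
    length (out p) + length (stack p) ≡⟨ length-++ (out p) ⟨
    length (out p ++ stack p)         ≡⟨ ↭-length (runPrefix-↭ (x ∷ xs) []) ⟩
    length ((x ∷ xs) ++ [])           ≡⟨ cong length (++-identityʳ (x ∷ xs)) ⟩
    suc (length xs)                   ∎
    where open ≡-Reasoning

  |out|≤|xs| : length (out p) ≤ length xs
  |out|≤|xs| = s≤s⁻¹ (subst (length (out p) <_) |out|+|stack|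
                            (m<m+n _ (runPrefix-nonempty xs z<s)))

stackSortIter-sorted : ∀ k xs {ys} → length xs ≤ k → Sorted ys → Sorted (stackSortIter k (xs ++ ys))
stackSortIter-sorted zero    []      _      ys↗ = ys↗
stackSortIter-sorted (suc k) xs |xs|≤1+k ys↗ with stackSort-shortens-prefix xs ys↗
... | xs′ , ys′ , eq , |xs′|≤ , ys′↗ rewrite eq =
  stackSortIter-sorted k xs′ (≤-trans |xs′|≤ (pred-mono-≤ |xs|≤1+k)) ys′↗

sorted-↭-idPerm : ∀ {n π} → Sorted π → π ↭ idPerm n → π ≡ idPerm n
sorted-↭-idPerm {n} π↗ π↭e = Pointwise-≡⇒≡
  (↗↭↗⇒≋ ≤-totalOrder π↗ (applyUpTo⁺₂ ≤-totalOrder suc n (λ i → n≤1+n (suc i))) (↭⇒↭ₛ π↭e))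

proposition2p5 : (n : ℕ) → 1 ≤ n → (A B : List ℕ) →
                 (A ++ B) ↭ idPerm n →
                 Linked _<_ B →
                 stackSortIter (length A) (A ++ B) ≡ idPerm n
proposition2p5 n _ A B AB↭e B↗ = sorted-↭-idPerm
  (stackSortIter-sorted (length A) A ≤-refl (Linked.map <⇒≤ B↗))
  (↭-trans (stackSortIter-↭ (length A) (A ++ B)) AB↭e)
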